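{- Let $n \geq 4$. Then \[ a_n(\sigma;123) = \begin{cases} 0 & \text{for } \sigma \in \{123, 312\},\\ 1 & \text{for } \sigma \in \{132, 213, 231, 321\},\end{cases} \qquad a_n(\sigma;132) = \begin{cases} 0 & \text{for } \sigma \in \{123, 231\},\\ 1 & \text{for } \sigma \in \{132, 213, 312, 321\}.\end{cases}\]
   Context: $\mathcal{S}_n$ is the set of permutations of $[n]=\{1,\dots,n\}$, written in one-line notation $\pi=\pi_1\pi_2\cdots\pi_n$ with $\pi_i=\pi(i)$. A permutation is cyclic if it consists of exactly one $n$-cycle. For a cyclic $\pi$, its standard cycle notation is $C(\pi)=(c_1,c_2,\dots,c_n)$ with $c_1=1$ and $c_i=\pi_{c_{i-1}}$ for $2\le i\le n$. A sequence of distinct integers $w_1\cdots w_m$ contains a pattern $\sigma\in\mathcal{S}_k$ if there are indices $i_1<\dots<i_k$ with $w_{i_1}\cdots w_{i_k}$ in the same relative order as $\sigma_1\cdots\sigma_k$; otherwise it avoids $\sigma$. For $\sigma,\tau\in\mathcal{S}_3$, $\mathcal{A}_n(\sigma;\tau)$ is the set of cyclic permutations $\pi\in\mathcal{S}_n$ whose one-line notation avoids $\sigma$ and whose cycle notation $C(\pi)=(c_1,\dots,c_n)$ (as the sequence $c_1c_2\cdots c_n$) avoids $\tau$; $a_n(\sigma;\tau)=|\mathcal{A}_n(\sigma;\tau)|$. -}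

module Defs where

open import Data.Nat using (ℕ; zero; suc; _<_)
open import Data.Fin using (Fin; toℕ) renaming (zero to fzero)
open import Data.Fin.Permutation using (Permutation′; _⟨$⟩ʳ_)
open import Data.Vec using (Vec; []; _∷_; lookup)
open import Data.Product using (Σ; ∃; ∃-syntax; _×_; _,_)
open import Function.Bundles using (_⇔_)
open import Relation.Binary.PropositionalEquality using (_≡_)
open import Relation.Nullary using (¬_)

-- A pattern σ ∈ S_k in one-line notation (values 1..k).
Pattern : ℕ → Set
Pattern k = Vec ℕ k

StrictlyIncreasing : ∀ {k m} → (Fin k → Fin m) → Set
StrictlyIncreasing {k} f = ∀ (a b : Fin k) → toℕ a < toℕ b → toℕ (f a) < toℕ (f b)

Contains : ∀ {k m n} → (Fin m → Fin n) → Pattern k → Set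
Contains {k} {m} w σ =
  ∃[ f ] (StrictlyIncreasing {k} {m} f ×
          (∀ (a b : Fin k) → (toℕ (w (f a)) < toℕ (w (f b))) ⇔ (lookup σ a < lookup σ b)))

Avoids : ∀ {k m n} → (Fin m → Fin n) → Pattern k → Set
Avoids w σ = ¬ Contains w σ

iter : ∀ {n} → Permutation′ n → ℕ → Fin n → Fin n
iter π zero    x = x
iter π (suc k) x = π ⟨$⟩ʳ (iter π k x)

-- Permutations of [n] with n = suc m; Fin.zero plays the role of 1.
-- One-line notation: i ↦ π(i).
oneLine : ∀ {m} → Permutation′ (suc m) → Fin (suc m) → Fin (suc m)
oneLine π i = π ⟨$⟩ʳ i

-- Cyclic: π is a single (suc m)-cycle, i.e. the orbit of 1 is all of [n].
Cyclic : ∀ {m} → Permutation′ (suc m) → Set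
Cyclic {m} π = ∀ (j : Fin (suc m)) → ∃[ k ] (iter π k fzero ≡ j)

-- Standard cycle notation C(π) = (c₁,…,c_n): c₁ = 1, c_i = π(c_{i-1}),
-- i.e. c_{i+1} = π^i(1) (0-based index i).
cycleSeq : ∀ {m} → Permutation′ (suc m) → Fin (suc m) → Fin (suc m)
cycleSeq π i = iter π (toℕ i) fzero

InA : ∀ {m} → Pattern 3 → Pattern 3 → Permutation′ (suc m) → Set
InA σ τ π = Cyclic π × Avoids (oneLine π) σ × Avoids (cycleSeq π) τ

CountZero : ℕ → Pattern 3 → Pattern 3 → Set
CountZero m σ τ = ∀ (π : Permutation′ (suc m)) → ¬ InA σ τ π

-- a_n(σ;τ) = 1 : exactly one element (permutations compared pointwise).
CountOne : ℕ → Pattern 3 → Pattern 3 → Set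
CountOne m σ τ =
  Σ (Permutation′ (suc m)) λ π → InA σ τ π ×
    (∀ (π′ : Permutation′ (suc m)) → InA σ τ π′ → ∀ i → π′ ⟨$⟩ʳ i ≡ π ⟨$⟩ʳ i)

p123 p132 p213 p231 p312 p321 : Pattern 3
p123 = 1 ∷ 2 ∷ 3 ∷ []
p132 = 1 ∷ 3 ∷ 2 ∷ []
p213 = 2 ∷ 1 ∷ 3 ∷ []
p231 = 2 ∷ 3 ∷ 1 ∷ []
p312 = 3 ∷ 1 ∷ 2 ∷ []
p321 = 3 ∷ 2 ∷ 1 ∷ []

-- If the cycle notation (1, c₂, …, cₙ) of π avoids 123, then c₂ > c₃ > ⋯ > cₙ, because 1 is its
-- smallest entry; as the cᵢ are 2, …, n this forces C(π) = (1, n, n−1, …, 2), i.e. π = n 1 2 ⋯ (n−1).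
-- Likewise avoiding 132 forces c₂ < ⋯ < cₙ, so C(π) = (1, 2, …, n) and π = 2 3 ⋯ n 1. Hence a_n(σ;τ)
-- is 1 or 0 according as this single permutation avoids σ or not, and n 1 2 ⋯ (n−1) contains exactly
-- the patterns 123 and 312, while 2 3 ⋯ n 1 contains exactly 123 and 231.

module Submission where

open import Defs
open import Data.Empty using (⊥-elim)
open import Data.Fin using (Fin; toℕ; fromℕ; fromℕ<; inject₁; lower₁) renaming (zero to fzero; suc to fsuc)
open import Data.Fin.Permutation using (Permutation′; _⟨$⟩ʳ_; _⟨$⟩ˡ_; inverseˡ; permutation)
open import Data.Fin.Properties
  using (toℕ-injective; toℕ-fromℕ; toℕ-fromℕ<; toℕ-inject₁; toℕ-lower₁; toℕ<n; toℕ≤pred[n]; pigeonhole; all?)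
import Data.Fin.Properties as Fin
open import Data.Nat using (ℕ; zero; suc; _+_; _*_; _∸_; _≤_; _<_; z≤n; s≤s; s≤s⁻¹; z<s; s<s; s<s⁻¹; NonZero)
open import Data.Nat.DivMod using (_%_; _/_; m≡m%n+[m/n]*n; m%n<n)
open import Data.Nat.Properties
open import Data.Product using (∃-syntax; _×_; _,_; proj₁; proj₂)
import Data.Product as ×
open import Data.Sum using (_⊎_; inj₁; inj₂)
import Data.Sum as ⊎
open import Data.Vec using ([]; _∷_; lookup)
open import Function using (_∘_)
open import Function.Bundles using (_⇔_; mk⇔; Equivalence)
open import Relation.Binary.Definitions using (tri<; tri≈; tri>)
open import Relation.Binary.PropositionalEquality using (_≡_; _≢_; refl; sym; trans; cong; subst; subst₂; module ≡-Reasoning)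
open import Relation.Nullary using (Dec; yes; no)
open import Relation.Nullary.Decidable using (_×-dec_; from-yes)

module _ {n : ℕ} (π : Permutation′ n) where

  ⟨$⟩ʳ-injective : ∀ {x y} → π ⟨$⟩ʳ x ≡ π ⟨$⟩ʳ y → x ≡ y
  ⟨$⟩ʳ-injective {x} {y} e = begin
    x                     ≡⟨ inverseˡ π ⟨
    π ⟨$⟩ˡ (π ⟨$⟩ʳ x)     ≡⟨ cong (π ⟨$⟩ˡ_) e ⟩
    π ⟨$⟩ˡ (π ⟨$⟩ʳ y)     ≡⟨ inverseˡ π ⟩
    y                     ∎
    where open ≡-Reasoning

  iter-+ : ∀ a b x → iter π (a + b) x ≡ iter π a (iter π b x)
  iter-+ zero    b x = refl
  iter-+ (suc a) b x = cong (π ⟨$⟩ʳ_) (iter-+ a b x)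

  iter-injective : ∀ a {x y} → iter π a x ≡ iter π a y → x ≡ y
  iter-injective zero    e = e
  iter-injective (suc a) e = iter-injective a (⟨$⟩ʳ-injective e)

  iter-periodic : ∀ d .{{_ : NonZero d}} {x} → iter π d x ≡ x → ∀ k → iter π k x ≡ iter π (k % d) x
  iter-periodic d {x} ret k = begin
    iter π k x                                   ≡⟨ cong (λ j → iter π j x) (m≡m%n+[m/n]*n k d) ⟩
    iter π (k % d + (k / d) * d) x               ≡⟨ iter-+ (k % d) ((k / d) * d) x ⟩
    iter π (k % d) (iter π ((k / d) * d) x)      ≡⟨ cong (iter π (k % d)) (iter-* (k / d)) ⟩
    iter π (k % d) x                             ∎
    where
    open ≡-Reasoning
    iter-* : ∀ q → iter π (q * d) x ≡ x
    iter-* zero    = refl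
    iter-* (suc q) = trans (iter-+ d (q * d) x) (trans (cong (iter π d) (iter-* q)) ret)

orbit : ∀ {m} → Permutation′ (suc m) → ℕ → Fin (suc m)
orbit π k = iter π k fzero

module Orbit {m : ℕ} (π : Permutation′ (suc m)) (cyclic : Cyclic π) where

  -- Returning after d + 1 ≤ m steps, the orbit would have at most d + 1 < m + 1 points.
  return-time-≥ : ∀ d → orbit π (suc d) ≡ fzero → m ≤ d
  return-time-≥ d ret = ≮⇒≥ λ d<m →
    let (i , j , i<j , same-residue) = pigeonhole (s≤s d<m) residue
    in Fin.<-irrefl (same-point same-residue) i<j
    where
    steps : Fin (suc m) → ℕ
    steps x = proj₁ (cyclic x)
    residue : Fin (suc m) → Fin (suc d)
    residue x = fromℕ< (m%n<n (steps x) (suc d))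
    reduce : ∀ x → orbit π (steps x % suc d) ≡ x
    reduce x = trans (sym (iter-periodic π (suc d) ret (steps x))) (proj₂ (cyclic x))
    same-point : ∀ {x y} → residue x ≡ residue y → x ≡ y
    same-point {x} {y} e = begin
      x                           ≡⟨ reduce x ⟨
      orbit π (steps x % suc d)   ≡⟨ cong (orbit π) (Fin.fromℕ<-injective _ _ _ _ e) ⟩
      orbit π (steps y % suc d)   ≡⟨ reduce y ⟩
      y                           ∎
      where open ≡-Reasoning

  orbit-distinct : ∀ {i j} → i < j → j ≤ m → orbit π i ≢ orbit π j
  orbit-distinct {i} {j} i<j j≤m e =
    <⇒≱ (<-≤-trans (≤-<-trans (m≤n+m d i) i+d<j) j≤m) (return-time-≥ d returns)
    where
    d : ℕ
    d = j ∸ suc i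
    i+1+d≡j : i + suc d ≡ j
    i+1+d≡j = trans (+-suc i d) (m+[n∸m]≡n i<j)
    i+d<j : i + d < j
    i+d<j = subst (_≤ j) (+-suc i d) (≤-reflexive i+1+d≡j)
    returns : orbit π (suc d) ≡ fzero
    returns = sym (iter-injective π i (trans e (trans (cong (orbit π) (sym i+1+d≡j)) (iter-+ π i (suc d) fzero))))

  orbit-closes : orbit π (suc m) ≡ fzero
  orbit-closes with pigeonhole (n<1+n (suc m)) (λ t → orbit π (toℕ t))
  ... | i , j , i<j , e with m≤n⇒m<n∨m≡n (toℕ≤pred[n] j)
  ...   | inj₁ j<1+m = ⊥-elim (orbit-distinct i<j (s≤s⁻¹ j<1+m) e)
  ...   | inj₂ j≡1+m = first-return (toℕ i) (subst (toℕ i <_) j≡1+m i<j) (trans e (cong (orbit π) j≡1+m))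
    where
    first-return : ∀ a → a < suc m → orbit π a ≡ orbit π (suc m) → orbit π (suc m) ≡ fzero
    first-return zero    _   e = sym e
    first-return (suc a) a<m e = ⊥-elim (orbit-distinct (s≤s⁻¹ a<m) ≤-refl (⟨$⟩ʳ-injective π e))

  orbit-covers : ∀ x → ∃[ k ] (k ≤ m × orbit π k ≡ x)
  orbit-covers x = k % suc m , s≤s⁻¹ (m%n<n k (suc m))
                 , trans (sym (iter-periodic π (suc m) orbit-closes k)) (proj₂ (cyclic x))
    where
    k : ℕ
    k = proj₁ (cyclic x)

  orbit-positive : ∀ {k} → 0 < k → k ≤ m → 0 < toℕ (orbit π k)
  orbit-positive 0<k k≤m = n≢0⇒n>0 λ cₖ≡0 → orbit-distinct 0<k k≤m (sym (toℕ-injective cₖ≡0))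

  orbit-step-≢ : ∀ {k} → suc k ≤ m → toℕ (orbit π k) ≢ toℕ (orbit π (suc k))
  orbit-step-≢ {k} k<m e = orbit-distinct (n<1+n k) k<m (toℕ-injective e)

cyclic-≗-from-orbit : ∀ {m} {π ρ : Permutation′ (suc m)} → Cyclic π → Cyclic ρ →
                      (∀ k → k ≤ m → orbit π k ≡ orbit ρ k) → ∀ x → π ⟨$⟩ʳ x ≡ ρ ⟨$⟩ʳ x
cyclic-≗-from-orbit {m} {π} {ρ} π-cyclic ρ-cyclic same x with Orbit.orbit-covers π π-cyclic x
... | k , k≤m , refl with m≤n⇒m<n∨m≡n k≤m
...   | inj₁ k<m  = trans (same (suc k) k<m) (cong (ρ ⟨$⟩ʳ_) (sym (same k k≤m)))
...   | inj₂ refl = trans (Orbit.orbit-closes π π-cyclic)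
                      (trans (sym (Orbit.orbit-closes ρ ρ-cyclic)) (cong (ρ ⟨$⟩ʳ_) (sym (same k k≤m))))

module _ (f : ℕ → ℕ) {a n : ℕ} where

  strictMono-squeeze : (∀ i → suc i ≤ n → f i < f (suc i)) → a ≤ f 0 → f n ≤ a + n →
                       ∀ i → i ≤ n → f i ≡ a + i
  strictMono-squeeze step a≤f₀ fₙ≤ i i≤n = ≤-antisym above (below i i≤n)
    where
    below : ∀ i → i ≤ n → a + i ≤ f i
    below zero    _  = subst (_≤ f 0) (sym (+-identityʳ a)) a≤f₀
    below (suc i) le = subst (_≤ f (suc i)) (sym (+-suc a i))
                         (≤-trans (s≤s (below i (≤-trans (n≤1+n i) le))) (step i le))
    room : ∀ u i → i + u ≡ n → f i + u ≤ f n
    room zero    i e = ≤-reflexive (trans (+-identityʳ (f i)) (cong f (trans (sym (+-identityʳ i)) e)))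
    room (suc u) i e = begin
      f i + suc u     ≡⟨ +-suc (f i) u ⟩
      suc (f i) + u   ≤⟨ +-monoˡ-≤ u (step i (subst (suc i ≤_) e′ (m≤m+n (suc i) u))) ⟩
      f (suc i) + u   ≤⟨ room u (suc i) e′ ⟩
      f n             ∎
      where
      open ≤-Reasoning
      e′ : suc i + u ≡ n
      e′ = trans (sym (+-suc i u)) e
    u : ℕ
    u = n ∸ i
    above : f i ≤ a + i
    above = +-cancelʳ-≤ u (f i) (a + i) (begin
      f i + u         ≤⟨ room u i (m+[n∸m]≡n i≤n) ⟩
      f n             ≤⟨ fₙ≤ ⟩
      a + n           ≡⟨ cong (a +_) (m+[n∸m]≡n i≤n) ⟨
      a + (i + u)     ≡⟨ +-assoc a i u ⟨
      a + i + u       ∎)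
      where open ≤-Reasoning

  strictAnti-squeeze : (∀ i → suc i ≤ n → f (suc i) < f i) → a ≤ f n → f 0 ≤ a + n →
                       ∀ i → i ≤ n → f i + i ≡ a + n
  strictAnti-squeeze step a≤fₙ f₀≤ i i≤n = ≤-antisym (≤-trans (above i i≤n) f₀≤) below
    where
    above : ∀ i → i ≤ n → f i + i ≤ f 0
    above zero    _  = ≤-reflexive (+-identityʳ (f 0))
    above (suc i) le = begin
      f (suc i) + suc i     ≡⟨ +-suc (f (suc i)) i ⟩
      suc (f (suc i)) + i   ≤⟨ +-monoˡ-≤ i (step i le) ⟩
      f i + i               ≤⟨ above i (≤-trans (n≤1+n i) le) ⟩
      f 0                   ∎
      where open ≤-Reasoning
    room : ∀ u i → i + u ≡ n → f n + u ≤ f i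
    room zero    i e = ≤-reflexive (trans (+-identityʳ (f n)) (cong f (sym (trans (sym (+-identityʳ i)) e))))
    room (suc u) i e = begin
      f n + suc u       ≡⟨ +-suc (f n) u ⟩
      suc (f n + u)     ≤⟨ s≤s (room u (suc i) e′) ⟩
      suc (f (suc i))   ≤⟨ step i (subst (suc i ≤_) e′ (m≤m+n (suc i) u)) ⟩
      f i               ∎
      where
      open ≤-Reasoning
      e′ : suc i + u ≡ n
      e′ = trans (sym (+-suc i u)) e
    u : ℕ
    u = n ∸ i
    below : a + n ≤ f i + i
    below = begin
      a + n           ≡⟨ cong (a +_) (m∸n+n≡m i≤n) ⟨
      a + (u + i)     ≡⟨ +-assoc a u i ⟨
      a + u + i       ≤⟨ +-monoˡ-≤ i (+-monoˡ-≤ u a≤fₙ) ⟩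
      f n + u + i     ≤⟨ +-monoˡ-≤ i (room u i (m+[n∸m]≡n i≤n)) ⟩
      f i + i         ∎
      where open ≤-Reasoning

pattern 0F = fzero
pattern 1F = fsuc fzero
pattern 2F = fsuc (fsuc fzero)

-- rank x y z sends the ranks 1, 2, 3 of a 3-pattern to x, y, z; every other argument is junk sent to z.
rank : ℕ → ℕ → ℕ → ℕ → ℕ
rank x y z 1 = x
rank x y z 2 = y
rank x y z _ = z

rank-< : ∀ {x y z} s t → x < y → y < z → 1 ≤ s → s < t → t ≤ 3 → rank x y z s < rank x y z t
rank-< 1 2 x<y y<z _ _ _ = x<y
rank-< 1 3 x<y y<z _ _ _ = <-trans x<y y<z
rank-< 2 3 x<y y<z _ _ _ = y<z
rank-< _ (suc (suc (suc (suc _)))) _ _ _ _ (s≤s (s≤s (s≤s ())))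
rank-< 1 1 _ _ _ (s≤s ()) _
rank-< (suc (suc _)) 1 _ _ _ (s≤s ()) _
rank-< (suc (suc _)) 2 _ _ _ (s≤s (s≤s ())) _
rank-< (suc (suc (suc _))) 3 _ _ _ (s≤s (s≤s (s≤s ()))) _

InRank : ℕ → Set
InRank s = 1 ≤ s × s ≤ 3

rank-<-⇔ : ∀ {x y z s t} → x < y → y < z → InRank s → InRank t → rank x y z s < rank x y z t ⇔ s < t
rank-<-⇔ {x} {y} {z} {s} {t} x<y y<z (1≤s , s≤3) (1≤t , t≤3) =
  mk⇔ reflects (λ s<t → rank-< s t x<y y<z 1≤s s<t t≤3)
  where
  reflects : rank x y z s < rank x y z t → s < t
  reflects r<r with <-cmp s t
  ... | tri< s<t _ _ = s<t
  ... | tri≈ _ refl _ = ⊥-elim (<-irrefl refl r<r)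
  ... | tri> _ _ t<s = ⊥-elim (<-asym r<r (rank-< t s x<y y<z 1≤t t<s s≤3))

Ranked : Pattern 3 → Set
Ranked σ = ∀ a → InRank (lookup σ a)

ranked? : ∀ σ → Dec (Ranked σ)
ranked? σ = all? λ a → (1 ≤? lookup σ a) ×-dec (lookup σ a ≤? 3)

contains-at : ∀ {m n} {w : Fin m → Fin n} (σ : Pattern 3) → Ranked σ →
              ∀ {i j k : Fin m} {x y z} → toℕ i < toℕ j → toℕ j < toℕ k → x < y → y < z →
              toℕ (w i) ≡ rank x y z (lookup σ 0F) →
              toℕ (w j) ≡ rank x y z (lookup σ 1F) →
              toℕ (w k) ≡ rank x y z (lookup σ 2F) → Contains w σ
contains-at {m} {w = w} σ ranked {i} {j} {k} {x} {y} {z} i<j j<k x<y y<z wi wj wk =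
  position , increasing , same-order
  where
  position : Fin 3 → Fin m
  position = lookup (i ∷ j ∷ k ∷ [])
  toℕ-position : ∀ a → toℕ (position a) ≡ rank (toℕ i) (toℕ j) (toℕ k) (suc (toℕ a))
  toℕ-position 0F = refl
  toℕ-position 1F = refl
  toℕ-position 2F = refl
  increasing : StrictlyIncreasing position
  increasing a b a<b = subst₂ _<_ (sym (toℕ-position a)) (sym (toℕ-position b))
    (rank-< (suc (toℕ a)) (suc (toℕ b)) i<j j<k (s≤s z≤n) (s≤s a<b) (toℕ<n b))
  value : ∀ a → toℕ (w (position a)) ≡ rank x y z (lookup σ a)
  value 0F = wi
  value 1F = wj
  value 2F = wk
  same-order : ∀ a b → toℕ (w (position a)) < toℕ (w (position b)) ⇔ lookup σ a < lookup σ b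
  same-order a b = subst₂ (λ u v → u < v ⇔ _) (sym (value a)) (sym (value b))
    (rank-<-⇔ x<y y<z (ranked a) (ranked b))

Contains-resp-≗ : ∀ {m n} {w w′ : Fin m → Fin n} {σ : Pattern 3} →
                  (∀ i → w i ≡ w′ i) → Contains w′ σ → Contains w σ
Contains-resp-≗ w≗w′ (f , increasing , same-order) = f , increasing , λ a b →
  subst₂ (λ u v → toℕ u < toℕ v ⇔ _) (sym (w≗w′ (f a))) (sym (w≗w′ (f b))) (same-order a b)

occurrence-reflects-< : ∀ {m n} {w : Fin m → Fin n} {σ : Pattern 3} (c : Contains w σ) →
                        ∀ a b → toℕ (w (proj₁ c a)) < toℕ (w (proj₁ c b)) → lookup σ a < lookup σ b
occurrence-reflects-< (_ , _ , same-order) a b = Equivalence.to (same-order a b)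

cycleSeq-contains-at : ∀ {m} (π : Permutation′ (suc m)) (σ : Pattern 3) → Ranked σ →
                       ∀ {j k x y z} → 0 < j → j < k → k ≤ m → x < y → y < z →
                       0 ≡ rank x y z (lookup σ 0F) →
                       toℕ (orbit π j) ≡ rank x y z (lookup σ 1F) →
                       toℕ (orbit π k) ≡ rank x y z (lookup σ 2F) → Contains (cycleSeq π) σ
cycleSeq-contains-at {m} π σ ranked {j} {k} 0<j j<k k≤m x<y y<z w₀ wⱼ wₖ =
  contains-at {w = cycleSeq π} σ ranked {0F} {at-j} {at-k}
    (subst (0 <_) (sym toℕ-at-j) 0<j) (subst₂ _<_ (sym toℕ-at-j) (sym toℕ-at-k) j<k) x<y y<z
    w₀ (trans (cong (toℕ ∘ orbit π) toℕ-at-j) wⱼ) (trans (cong (toℕ ∘ orbit π) toℕ-at-k) wₖ)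
  where
  j<1+m : j < suc m
  j<1+m = s≤s (≤-trans (<⇒≤ j<k) k≤m)
  at-j at-k : Fin (suc m)
  at-j = fromℕ< j<1+m
  at-k = fromℕ< (s≤s k≤m)
  toℕ-at-j : toℕ at-j ≡ j
  toℕ-at-j = toℕ-fromℕ< j<1+m
  toℕ-at-k : toℕ at-k ≡ k
  toℕ-at-k = toℕ-fromℕ< (s≤s k≤m)

-- With 0 playing the role of 1, down and up are the one-line notations n 1 2 ⋯ (n−1) and 2 3 ⋯ n 1.
module _ {m : ℕ} where

  down : Fin (suc m) → Fin (suc m)
  down fzero    = fromℕ m
  down (fsuc i) = inject₁ i

  up : Fin (suc m) → Fin (suc m)
  up i with m ≟ toℕ i
  ... | yes _   = fzero
  ... | no m≢i = fsuc (lower₁ i m≢i)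

  toℕ-down-fzero : toℕ (down fzero) ≡ m
  toℕ-down-fzero = toℕ-fromℕ m

  toℕ-down-suc : ∀ x → 0 < toℕ x → suc (toℕ (down x)) ≡ toℕ x
  toℕ-down-suc (fsuc i) _ = cong suc (toℕ-inject₁ i)

  up-last : ∀ x → toℕ x ≡ m → up x ≡ fzero
  up-last x x≡m with m ≟ toℕ x
  ... | yes _   = refl
  ... | no m≢x = ⊥-elim (m≢x (sym x≡m))

  toℕ-up : ∀ x → toℕ x < m → toℕ (up x) ≡ suc (toℕ x)
  toℕ-up x x<m with m ≟ toℕ x
  ... | yes m≡x = ⊥-elim (<-irrefl (sym m≡x) x<m)
  ... | no m≢x = cong suc (toℕ-lower₁ x m≢x)

  up-down : ∀ x → up (down x) ≡ x
  up-down fzero    = up-last (down fzero) toℕ-down-fzero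
  up-down (fsuc i) = toℕ-injective (begin
    toℕ (up (inject₁ i))   ≡⟨ toℕ-up (inject₁ i) (subst (_< m) (sym (toℕ-inject₁ i)) (toℕ<n i)) ⟩
    suc (toℕ (inject₁ i))  ≡⟨ cong suc (toℕ-inject₁ i) ⟩
    suc (toℕ i)            ∎)
    where open ≡-Reasoning

  down-up : ∀ x → down (up x) ≡ x
  down-up x with m≤n⇒m<n∨m≡n (toℕ≤pred[n] x)
  ... | inj₁ x<m = toℕ-injective (suc-injective (begin
    suc (toℕ (down (up x)))  ≡⟨ toℕ-down-suc (up x) (subst (0 <_) (sym (toℕ-up x x<m)) z<s) ⟩
    toℕ (up x)               ≡⟨ toℕ-up x x<m ⟩
    suc (toℕ x)              ∎))
    where open ≡-Reasoning
  ... | inj₂ x≡m = toℕ-injective (trans (cong (toℕ ∘ down) (up-last x x≡m)) (trans toℕ-down-fzero (sym x≡m)))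

cycleUp cycleDown : ∀ {m} → Permutation′ (suc m)
cycleUp   = permutation up down up-down down-up
cycleDown = permutation down up down-up up-down

module _ {m : ℕ} where

  toℕ-orbit-cycleUp : ∀ k → k ≤ m → toℕ (orbit (cycleUp {m}) k) ≡ k
  toℕ-orbit-cycleUp zero    _   = refl
  toℕ-orbit-cycleUp (suc k) k<m = begin
    toℕ (up (orbit cycleUp k))   ≡⟨ toℕ-up (orbit cycleUp k) (subst (_< m) (sym ih) k<m) ⟩
    suc (toℕ (orbit cycleUp k))  ≡⟨ cong suc ih ⟩
    suc k                        ∎
    where
    open ≡-Reasoning
    ih : toℕ (orbit cycleUp k) ≡ k
    ih = toℕ-orbit-cycleUp k (<⇒≤ k<m)

  toℕ-orbit-cycleDown : ∀ t → suc t ≤ m → toℕ (orbit (cycleDown {m}) (suc t)) + t ≡ m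
  toℕ-orbit-cycleDown zero    _      = trans (+-identityʳ _) toℕ-down-fzero
  toℕ-orbit-cycleDown (suc t) 2+t≤m = begin
    toℕ (down x) + suc t      ≡⟨ +-suc (toℕ (down x)) t ⟩
    suc (toℕ (down x)) + t    ≡⟨ cong (_+ t) (toℕ-down-suc x x≢0) ⟩
    toℕ x + t                 ≡⟨ ih ⟩
    m                         ∎
    where
    open ≡-Reasoning
    x : Fin (suc m)
    x = orbit cycleDown (suc t)
    ih : toℕ x + t ≡ m
    ih = toℕ-orbit-cycleDown t (<⇒≤ 2+t≤m)
    x≢0 : 0 < toℕ x
    x≢0 = n≢0⇒n>0 λ x≡0 → <-irrefl (trans (cong (_+ t) (sym x≡0)) ih) (≤-trans (n≤1+n (suc t)) 2+t≤m)

  cycleUp-cyclic : Cyclic (cycleUp {m})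
  cycleUp-cyclic x = toℕ x , toℕ-injective (toℕ-orbit-cycleUp (toℕ x) (toℕ≤pred[n] x))

  cycleDown-cyclic : Cyclic (cycleDown {m})
  cycleDown-cyclic fzero    = 0 , refl
  cycleDown-cyclic (fsuc i) = suc t , toℕ-injective (+-cancelʳ-≡ t _ _ (begin
    toℕ (orbit cycleDown (suc t)) + t   ≡⟨ toℕ-orbit-cycleDown t (subst (suc t ≤_) e (s≤s (m≤n+m t (toℕ i)))) ⟩
    m                                   ≡⟨ e ⟨
    suc (toℕ i) + t                     ∎))
    where
    open ≡-Reasoning
    t : ℕ
    t = m ∸ suc (toℕ i)
    e : suc (toℕ i) + t ≡ m
    e = m+[n∸m]≡n (toℕ≤pred[n] (fsuc i))

  down-increasing : ∀ {p q : Fin (suc m)} → 0 < toℕ p → toℕ p < toℕ q → toℕ (down p) < toℕ (down q)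
  down-increasing {fsuc p} {fsuc q} _ p<q =
    subst₂ _<_ (sym (toℕ-inject₁ p)) (sym (toℕ-inject₁ q)) (s<s⁻¹ p<q)

  down-fzero-max : ∀ {q : Fin (suc m)} → 0 < toℕ q → toℕ (down q) < toℕ (down {m} fzero)
  down-fzero-max {fsuc q} _ = subst₂ _<_ (sym (toℕ-inject₁ q)) (sym toℕ-down-fzero) (toℕ<n q)

  down-shape : ∀ (p : Fin (suc m)) {q r : Fin (suc m)} → toℕ p < toℕ q → toℕ q < toℕ r →
               toℕ (down q) < toℕ (down r) × (toℕ (down p) < toℕ (down q) ⊎ toℕ (down r) < toℕ (down p))
  down-shape fzero    p<q q<r = down-increasing p<q q<r , inj₂ (down-fzero-max (<-trans p<q q<r))
  down-shape (fsuc p) p<q q<r = down-increasing (<-trans z<s p<q) q<r , inj₁ (down-increasing z<s p<q)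

  up-increasing : ∀ {p q : Fin (suc m)} → toℕ p < toℕ q → toℕ q < m → toℕ (up p) < toℕ (up q)
  up-increasing {p} {q} p<q q<m = subst₂ _<_ (sym (toℕ-up p (<-trans p<q q<m))) (sym (toℕ-up q q<m)) (s<s p<q)

  up-shape : ∀ {p q : Fin (suc m)} r → toℕ p < toℕ q → toℕ q < toℕ r →
             toℕ (up p) < toℕ (up q) × (toℕ (up q) < toℕ (up r) ⊎ toℕ (up r) < toℕ (up p))
  up-shape {p} r p<q q<r with m≤n⇒m<n∨m≡n (toℕ≤pred[n] r)
  ... | inj₁ r<m = up-increasing p<q (<-trans q<r r<m) , inj₁ (up-increasing q<r r<m)
  ... | inj₂ r≡m = up-increasing p<q (<-≤-trans q<r (≤-reflexive r≡m))
                 , inj₂ (subst (λ x → toℕ x < toℕ (up p)) (sym (up-last r r≡m))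
                          (subst (0 <_) (sym (toℕ-up p (<-trans p<q (<-≤-trans q<r (≤-reflexive r≡m))))) z<s))

  orbit-cycleDown-decreasing : ∀ {i j} → 0 < i → i < j → j ≤ m →
                               toℕ (orbit (cycleDown {m}) j) < toℕ (orbit (cycleDown {m}) i)
  orbit-cycleDown-decreasing {suc a} {suc b} _ a<b b<m = ≰⇒> λ cᵢ≤cⱼ →
    <-irrefl (trans (toℕ-orbit-cycleDown a (<⇒≤ (<-≤-trans a<b b<m))) (sym (toℕ-orbit-cycleDown b b<m)))
             (+-mono-≤-< cᵢ≤cⱼ (s<s⁻¹ a<b))

avoiding-132-orbit : ∀ {m} {π : Permutation′ (suc m)} → Cyclic π → Avoids (cycleSeq π) p132 →
                     ∀ k → k ≤ m → toℕ (orbit π k) ≡ k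
avoiding-132-orbit {m} {π} cyclic avoids = strictMono-squeeze c step z≤n (toℕ≤pred[n] (orbit π m))
  where
  open Orbit π cyclic
  c : ℕ → ℕ
  c = toℕ ∘ orbit π
  step : ∀ k → suc k ≤ m → c k < c (suc k)
  step zero    0<m = orbit-positive z<s 0<m
  step (suc k) k<m with <-cmp (c (suc k)) (c (2 + k))
  ... | tri< lt _ _ = lt
  ... | tri≈ _ eq _ = ⊥-elim (orbit-step-≢ k<m eq)
  ... | tri> _ _ gt = ⊥-elim (avoids (cycleSeq-contains-at π p132 (from-yes (ranked? p132))
                                       z<s (n<1+n (suc k)) k<m (orbit-positive z<s k<m) gt refl refl refl))

avoiding-123-orbit : ∀ {m} {π : Permutation′ (suc m)} → Cyclic π → Avoids (cycleSeq π) p123 →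
                     ∀ t → suc t ≤ m → toℕ (orbit π (suc t)) + t ≡ m
avoiding-123-orbit {suc n} {π} cyclic avoids t (s≤s t≤n) =
  strictAnti-squeeze (c ∘ suc) step (orbit-positive z<s ≤-refl) (toℕ≤pred[n] (orbit π 1)) t t≤n
  where
  open Orbit π cyclic
  c : ℕ → ℕ
  c = toℕ ∘ orbit π
  step : ∀ i → suc i ≤ n → c (2 + i) < c (suc i)
  step i i<n with <-cmp (c (suc i)) (c (2 + i))
  ... | tri> _ _ gt = gt
  ... | tri≈ _ eq _ = ⊥-elim (orbit-step-≢ (s≤s i<n) eq)
  ... | tri< lt _ _ = ⊥-elim (avoids (cycleSeq-contains-at π p123 (from-yes (ranked? p123))
                                       z<s (n<1+n (suc i)) (s≤s i<n) (orbit-positive z<s (s≤s (<⇒≤ i<n))) lt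
                                       refl refl refl))

module _ {m : ℕ} {σ : Pattern 3} where

  oneLine-cycleDown-shape : Contains (oneLine (cycleDown {m})) σ →
    lookup σ 1F < lookup σ 2F × (lookup σ 0F < lookup σ 1F ⊎ lookup σ 2F < lookup σ 0F)
  oneLine-cycleDown-shape c@(f , increasing , _) =
    ×.map (reflect 1F 2F) (⊎.map (reflect 0F 1F) (reflect 2F 0F))
      (down-shape (f 0F) (increasing 0F 1F z<s) (increasing 1F 2F (s<s z<s)))
    where
    reflect : ∀ a b → toℕ (down (f a)) < toℕ (down (f b)) → lookup σ a < lookup σ b
    reflect = occurrence-reflects-< {w = oneLine (cycleDown {m})} {σ = σ} c

  oneLine-cycleUp-shape : Contains (oneLine (cycleUp {m})) σ →
    lookup σ 0F < lookup σ 1F × (lookup σ 1F < lookup σ 2F ⊎ lookup σ 2F < lookup σ 0F)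
  oneLine-cycleUp-shape c@(f , increasing , _) =
    ×.map (reflect 0F 1F) (⊎.map (reflect 1F 2F) (reflect 2F 0F))
      (up-shape (f 2F) (increasing 0F 1F z<s) (increasing 1F 2F (s<s z<s)))
    where
    reflect : ∀ a b → toℕ (up (f a)) < toℕ (up (f b)) → lookup σ a < lookup σ b
    reflect = occurrence-reflects-< {w = oneLine (cycleUp {m})} {σ = σ} c

  cycleSeq-cycleDown-shape : Contains (cycleSeq (cycleDown {m})) σ → lookup σ 2F < lookup σ 1F
  cycleSeq-cycleDown-shape c@(f , increasing , _) =
    occurrence-reflects-< {w = cycleSeq cycleDown} {σ = σ} c 2F 1F
      (orbit-cycleDown-decreasing (≤-<-trans z≤n (increasing 0F 1F z<s)) (increasing 1F 2F (s<s z<s))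
                                  (toℕ≤pred[n] (f 2F)))

  cycleSeq-cycleUp-shape : Contains (cycleSeq (cycleUp {m})) σ → lookup σ 1F < lookup σ 2F
  cycleSeq-cycleUp-shape c@(f , increasing , _) =
    occurrence-reflects-< {w = cycleSeq cycleUp} {σ = σ} c 1F 2F
      (subst₂ _<_ (sym (toℕ-orbit-cycleUp _ (toℕ≤pred[n] (f 1F))))
                  (sym (toℕ-orbit-cycleUp _ (toℕ≤pred[n] (f 2F))))
                  (increasing 1F 2F (s<s z<s)))

module _ {m : ℕ} where

  oneLine-cycleDown-avoids-132 : Avoids (oneLine (cycleDown {m})) p132
  oneLine-cycleDown-avoids-132 c with oneLine-cycleDown-shape {σ = p132} c
  ... | s≤s (s≤s ()) , _

  oneLine-cycleDown-avoids-213 : Avoids (oneLine (cycleDown {m})) p213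
  oneLine-cycleDown-avoids-213 c with oneLine-cycleDown-shape {σ = p213} c
  ... | _ , inj₁ (s≤s ())
  ... | _ , inj₂ (s≤s (s≤s ()))

  oneLine-cycleDown-avoids-231 : Avoids (oneLine (cycleDown {m})) p231
  oneLine-cycleDown-avoids-231 c with oneLine-cycleDown-shape {σ = p231} c
  ... | s≤s () , _

  oneLine-cycleDown-avoids-321 : Avoids (oneLine (cycleDown {m})) p321
  oneLine-cycleDown-avoids-321 c with oneLine-cycleDown-shape {σ = p321} c
  ... | s≤s () , _

  oneLine-cycleUp-avoids-132 : Avoids (oneLine (cycleUp {m})) p132
  oneLine-cycleUp-avoids-132 c with oneLine-cycleUp-shape {σ = p132} c
  ... | _ , inj₁ (s≤s (s≤s ()))
  ... | _ , inj₂ (s≤s ())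

  oneLine-cycleUp-avoids-213 : Avoids (oneLine (cycleUp {m})) p213
  oneLine-cycleUp-avoids-213 c with oneLine-cycleUp-shape {σ = p213} c
  ... | s≤s () , _

  oneLine-cycleUp-avoids-312 : Avoids (oneLine (cycleUp {m})) p312
  oneLine-cycleUp-avoids-312 c with oneLine-cycleUp-shape {σ = p312} c
  ... | s≤s () , _

  oneLine-cycleUp-avoids-321 : Avoids (oneLine (cycleUp {m})) p321
  oneLine-cycleUp-avoids-321 c with oneLine-cycleUp-shape {σ = p321} c
  ... | s≤s (s≤s ()) , _

  cycleSeq-cycleDown-avoids-123 : Avoids (cycleSeq (cycleDown {m})) p123
  cycleSeq-cycleDown-avoids-123 c with cycleSeq-cycleDown-shape {σ = p123} c
  ... | s≤s (s≤s ())

  cycleSeq-cycleUp-avoids-132 : Avoids (cycleSeq (cycleUp {m})) p132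
  cycleSeq-cycleUp-avoids-132 c with cycleSeq-cycleUp-shape {σ = p132} c
  ... | s≤s (s≤s ())

module _ {k : ℕ} where

  oneLine-cycleDown-contains-123 : Contains (oneLine (cycleDown {3 + k})) p123
  oneLine-cycleDown-contains-123 =
    contains-at {w = oneLine (cycleDown {3 + k})} p123 (from-yes (ranked? p123))
      {1F} {2F} {fsuc 2F} {0} {1} {2} (s<s z<s) (s<s (s<s z<s)) z<s (s<s z<s)
      refl refl refl

  oneLine-cycleDown-contains-312 : Contains (oneLine (cycleDown {3 + k})) p312
  oneLine-cycleDown-contains-312 =
    contains-at {w = oneLine (cycleDown {3 + k})} p312 (from-yes (ranked? p312))
      {0F} {1F} {2F} {0} {1} {3 + k} z<s (s<s z<s) z<s (s<s z<s)
      toℕ-down-fzero refl refl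

  oneLine-cycleUp-contains-123 : Contains (oneLine (cycleUp {3 + k})) p123
  oneLine-cycleUp-contains-123 =
    contains-at {w = oneLine (cycleUp {3 + k})} p123 (from-yes (ranked? p123))
      {0F} {1F} {2F} {1} {2} {3} z<s (s<s z<s) (s<s z<s) (s<s (s<s z<s))
      (toℕ-up {3 + k} 0F z<s) (toℕ-up {3 + k} 1F (s<s z<s)) (toℕ-up {3 + k} 2F (s<s (s<s z<s)))

  oneLine-cycleUp-contains-231 : Contains (oneLine (cycleUp {3 + k})) p231
  oneLine-cycleUp-contains-231 =
    contains-at {w = oneLine (cycleUp {3 + k})} p231 (from-yes (ranked? p231))
      {0F} {1F} {fromℕ (3 + k)} {0} {1} {2} z<s (s<s z<s) z<s (s<s z<s)
      (toℕ-up {3 + k} 0F z<s) (toℕ-up {3 + k} 1F (s<s z<s)) (cong toℕ (up-last {3 + k} _ (toℕ-fromℕ (3 + k))))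

record UniqueCyclicAvoider (m : ℕ) (τ : Pattern 3) : Set where
  field
    ρ       : Permutation′ (suc m)
    cyclic  : Cyclic ρ
    avoids  : Avoids (cycleSeq ρ) τ
    unique  : ∀ π → Cyclic π → Avoids (cycleSeq π) τ → ∀ x → π ⟨$⟩ʳ x ≡ ρ ⟨$⟩ʳ x

module _ {m : ℕ} {τ : Pattern 3} (U : UniqueCyclicAvoider m τ) where
  open UniqueCyclicAvoider U

  count-zero : ∀ σ → Contains (oneLine ρ) σ → CountZero m σ τ
  count-zero σ contains π (π-cyclic , π-avoids , π-cycle-avoids) =
    π-avoids (Contains-resp-≗ {σ = σ} (unique π π-cyclic π-cycle-avoids) contains)

  count-one : ∀ σ → Avoids (oneLine ρ) σ → CountOne m σ τ
  count-one _ ρ-avoids = ρ , (cyclic , ρ-avoids , avoids) , λ π (π-cyclic , _ , π-cycle-avoids) →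
    unique π π-cyclic π-cycle-avoids

cycleDown-unique : ∀ {m} → UniqueCyclicAvoider m p123
cycleDown-unique {m} = record
  { ρ      = cycleDown
  ; cyclic = cycleDown-cyclic
  ; avoids = cycleSeq-cycleDown-avoids-123
  ; unique = λ π cyclic avoids → cyclic-≗-from-orbit cyclic cycleDown-cyclic (same-orbit π cyclic avoids)
  }
  where
  same-orbit : ∀ π → Cyclic π → Avoids (cycleSeq π) p123 → ∀ k → k ≤ m → orbit π k ≡ orbit cycleDown k
  same-orbit π cyclic avoids zero    _   = refl
  same-orbit π cyclic avoids (suc t) t<m = toℕ-injective (+-cancelʳ-≡ t _ _
    (trans (avoiding-123-orbit cyclic avoids t t<m) (sym (toℕ-orbit-cycleDown t t<m))))

cycleUp-unique : ∀ {m} → UniqueCyclicAvoider m p132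
cycleUp-unique {m} = record
  { ρ      = cycleUp
  ; cyclic = cycleUp-cyclic
  ; avoids = cycleSeq-cycleUp-avoids-132
  ; unique = λ π cyclic avoids → cyclic-≗-from-orbit cyclic cycleUp-cyclic λ k k≤m →
               toℕ-injective (trans (avoiding-132-orbit cyclic avoids k k≤m) (sym (toℕ-orbit-cycleUp k k≤m)))
  }

theorem2p1 : ∀ (m : ℕ) → 3 ≤ m →
    (CountZero m p123 p123 × CountZero m p312 p123 ×
     CountOne m p132 p123 × CountOne m p213 p123 × CountOne m p231 p123 × CountOne m p321 p123)
    ×
    (CountZero m p123 p132 × CountZero m p231 p132 ×
     CountOne m p132 p132 × CountOne m p213 p132 × CountOne m p312 p132 × CountOne m p321 p132)
theorem2p1 (suc (suc (suc k))) (s≤s (s≤s (s≤s _))) =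
  ( count-zero cycleDown-unique p123 oneLine-cycleDown-contains-123
  , count-zero cycleDown-unique p312 oneLine-cycleDown-contains-312
  , count-one cycleDown-unique p132 oneLine-cycleDown-avoids-132
  , count-one cycleDown-unique p213 oneLine-cycleDown-avoids-213
  , count-one cycleDown-unique p231 oneLine-cycleDown-avoids-231
  , count-one cycleDown-unique p321 oneLine-cycleDown-avoids-321 )
  ,
  ( count-zero cycleUp-unique p123 oneLine-cycleUp-contains-123
  , count-zero cycleUp-unique p231 oneLine-cycleUp-contains-231
  , count-one cycleUp-unique p132 oneLine-cycleUp-avoids-132
  , count-one cycleUp-unique p213 oneLine-cycleUp-avoids-213
  , count-one cycleUp-unique p312 oneLine-cycleUp-avoids-312
  , count-one cycleUp-unique p321 oneLine-cycleUp-avoids-321 )
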